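{- Let $j,k\ge1$ be fixed integers. If $m,n\ge1$ are integers with $\nu(m)=\nu(n)$, then $E_{j,k}(m)=E_{j,k}(n)$; i.e. $E_{j,k}(n)$ depends only on $\nu(n)$.
   Context: Writing $n=p_1^{v_1}\cdots p_{\omega(n)}^{v_{\omega(n)}}$ with distinct primes $p_i$ and $v_1\ge\dots\ge v_{\omega(n)}\ge1$, $\nu(n):=(v_1,\dots,v_{\omega(n)})$ (the non-increasing vector of exponents). $\mathcal{D}_n$ is the set of positive divisors of $n$. A set $U\subseteq\mathcal{D}_n^j$ is called regular if every tuple in $U$ has pairwise coprime entries. A map $g:U_g\to\mathcal{D}_n$ on a regular set $U_g\subseteq\mathcal{D}_n^j$ is $k$-regular if (0) $\gcd(g(d_1,\dots,d_j),d_i)=1$ for all $(d_1,\dots,d_j)\in U_g$ and all $i$; (1) for each $i$ and each fixed choice of the other coordinates and of $d$, the equation $g(d_1,\dots,d_{i-1},z,d_{i+1},\dots,d_j)=d$ has at most $k$ solutions $z$ with the tuple in $U_g$; (2) under the same fixing, $z\,g(d_1,\dots,d_{i-1},z,d_{i+1},\dots,d_j)=d$ has at most $k$ solutions $z$ with the tuple in $U_g$. $E_{j,k}(n)$ is the maximum of $|U_g|$ over all $k$-regular maps $g$. -}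

module Defs where

open import Data.Nat using (ℕ; _*_; _^_; _≤_; _≥_)
open import Data.Nat.Divisibility using (_∣_)
open import Data.Nat.Coprimality using (Coprime)
open import Data.Nat.Primality using (Prime)
open import Data.Fin using (Fin)
open import Data.Vec using (Vec; lookup; _[_]≔_)
open import Data.List using (List; map; length)
open import Data.Nat.ListAction using (product)
open import Data.List.Membership.Propositional using (_∈_)
open import Data.List.Relation.Unary.All using (All)
open import Data.List.Relation.Unary.AllPairs using (AllPairs)
open import Data.List.Relation.Unary.Unique.Propositional using (Unique)
open import Data.Product using (Σ; _×_; _,_; proj₁; proj₂; ∃)
open import Relation.Binary.PropositionalEquality using (_≡_; _≢_)

-- ν(n) = v : n = ∏ p_i ^ v_i with distinct primes p_i, v non-increasing,
-- all v_i ≥ 1.  (A factorisation is a list of (prime, exponent) pairs.)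

HasNu : ℕ → List ℕ → Set
HasNu n v = Σ (List (ℕ × ℕ)) λ fs →
    All (λ pe → Prime (proj₁ pe)) fs
  × Unique (map proj₁ fs)
  × All (λ e → 1 ≤ e) (map proj₂ fs)
  × AllPairs _≥_ (map proj₂ fs)
  × map proj₂ fs ≡ v
  × n ≡ product (map (λ pe → proj₁ pe ^ proj₂ pe) fs)

-- Finite subsets of D_n^j are duplicate-free lists of length-j vectors.

DivTuple : ∀ {j} → ℕ → Vec ℕ j → Set
DivTuple {j} n t = (i : Fin j) → lookup t i ∣ n

PairwiseCoprime : ∀ {j} → Vec ℕ j → Set
PairwiseCoprime {j} t = (i i' : Fin j) → i ≢ i' → Coprime (lookup t i) (lookup t i')

RegularSet : (n j : ℕ) → List (Vec ℕ j) → Set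
RegularSet n j U = Unique U × All (λ t → DivTuple n t × PairwiseCoprime t) U

AtMost : ℕ → (ℕ → Set) → Set
AtMost k P = (zs : List ℕ) → Unique zs → All P zs → length zs ≤ k

-- g : U → D_n is k-regular (g given as a total function, only its values on U matter)
KRegular : (n j k : ℕ) → List (Vec ℕ j) → (Vec ℕ j → ℕ) → Set
KRegular n j k U g =
    RegularSet n j U
  × All (λ t → g t ∣ n) U
  × All (λ t → (i : Fin j) → Coprime (g t) (lookup t i)) U
  × ((i : Fin j) (t : Vec ℕ j) (d : ℕ) →
       AtMost k (λ z → ((t [ i ]≔ z) ∈ U) × g (t [ i ]≔ z) ≡ d))
  × ((i : Fin j) (t : Vec ℕ j) (d : ℕ) →
       AtMost k (λ z → ((t [ i ]≔ z) ∈ U) × z * g (t [ i ]≔ z) ≡ d))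

IsE : (j k n e : ℕ) → Set
IsE j k n e =
    (Σ (List (Vec ℕ j)) λ U → Σ (Vec ℕ j → ℕ) λ g → KRegular n j k U g × length U ≡ e)
  × ((U : List (Vec ℕ j)) (g : Vec ℕ j → ℕ) → KRegular n j k U g → length U ≤ e)

{-# OPTIONS --safe #-}
-- If m = ∏ pᵢ^aᵢ and n = ∏ qᵢ^aᵢ, then ∏ pᵢ^bᵢ ↦ ∏ qᵢ^bᵢ (bᵢ ≤ aᵢ) is an isomorphism
-- between the divisibility lattices of m and n. Such an isomorphism preserves
-- coprimality and products of coprime divisors, which is all that k-regularity
-- refers to, so it carries every k-regular map on a set U ⊆ D_m^j to a k-regular map
-- on a set of the same size in D_n^j, and its inverse carries them back.
module Submission where

open import Defs
open import Data.Nat using (ℕ; zero; suc; _*_; _^_; _≤_; z≤n; s≤s; nonTrivial⇒≢1)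
open import Data.Nat.Properties using (*-identityˡ; *-assoc; *-comm; ≤-antisym; m≤n⇒m≤1+n)
open import Data.Nat.Divisibility
open import Data.Nat.Coprimality as Coprime using (Coprime; coprime-divisor; coprime⇒gcd≡1)
open import Data.Nat.Primality using (Prime; prime⇒irreducible; prime⇒nonZero; prime⇒nonTrivial; euclidsLemma)
open import Data.Nat.GCD using (gcd)
open import Data.Nat.LCM using (lcm; lcm-least; m∣lcm[m,n]; n∣lcm[m,n]; gcd*lcm)
open import Data.Nat.ListAction using (product)
open import Data.Fin using (Fin; zero; suc)
open import Data.Vec using (Vec; []; _∷_; lookup; _[_]≔_)
import Data.Vec as Vec
import Data.Vec.Properties as Vecₚ
open import Data.List using (List; []; _∷_; map; length)
import Data.List.Properties as Listₚ
open import Data.List.Membership.Propositional using (_∈_)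
open import Data.List.Membership.Propositional.Properties using (∈-map⁻)
open import Data.List.Relation.Unary.All as All using (All; []; _∷_)
import Data.List.Relation.Unary.All.Properties as Allₚ
open import Data.List.Relation.Unary.AllPairs using ([]; _∷_)
open import Data.List.Relation.Unary.Unique.Propositional using (Unique)
import Data.List.Relation.Unary.Unique.Propositional.Properties as Uniqueₚ
open import Data.Product using (Σ; _×_; _,_; proj₁; proj₂)
open import Data.Sum using (inj₁; inj₂)
open import Data.Empty using (⊥-elim)
open import Function using (id; _∘_)
open import Function.Bundles using (_⇔_; mk⇔)
open import Relation.Nullary using (¬_; yes; no)
open import Relation.Binary.PropositionalEquality

prime∤1 : ∀ {p} → Prime p → ¬ p ∣ 1
prime∤1 p-prime p∣1 = nonTrivial⇒≢1 {{prime⇒nonTrivial p-prime}} (∣1⇒≡1 p∣1)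

prime∤⇒coprime : ∀ {p d} → Prime p → ¬ p ∣ d → Coprime d p
prime∤⇒coprime p-prime p∤d (c∣d , c∣p) with prime⇒irreducible p-prime c∣p
... | inj₁ c≡1 = c≡1
... | inj₂ refl = ⊥-elim (p∤d c∣d)

prime∣prime⇒≡ : ∀ {p q} → Prime p → Prime q → p ∣ q → p ≡ q
prime∣prime⇒≡ p-prime q-prime p∣q with prime⇒irreducible q-prime p∣q
... | inj₁ refl = ⊥-elim (prime∤1 p-prime ∣-refl)
... | inj₂ p≡q = p≡q

prime∣^⇒≡ : ∀ {p q} → Prime p → Prime q → ∀ b → p ∣ q ^ b → p ≡ q
prime∣^⇒≡ p-prime q-prime zero p∣1 = ⊥-elim (prime∤1 p-prime p∣1)
prime∣^⇒≡ p-prime q-prime (suc b) p∣q^b+1 with euclidsLemma _ _ p-prime p∣q^b+1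
... | inj₁ p∣q = prime∣prime⇒≡ p-prime q-prime p∣q
... | inj₂ p∣q^b = prime∣^⇒≡ p-prime q-prime b p∣q^b

^-monoʳ-∣ : ∀ p {a b} → a ≤ b → p ^ a ∣ p ^ b
^-monoʳ-∣ p z≤n = 1∣ _
^-monoʳ-∣ p (s≤s a≤b) = *-monoʳ-∣ p (^-monoʳ-∣ p a≤b)

prime-*-cancelˡ-∣ : ∀ {p x y} → Prime p → p * x ∣ p * y → x ∣ y
prime-*-cancelˡ-∣ {p} p-prime = *-cancelˡ-∣ p {{prime⇒nonZero p-prime}}

prime∤⇒∣p^b*⇒∣ : ∀ {p e d} → Prime p → ¬ p ∣ e → ∀ b → e ∣ p ^ b * d → e ∣ d
prime∤⇒∣p^b*⇒∣ p-prime p∤e zero e∣d = subst (_ ∣_) (*-identityˡ _) e∣d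
prime∤⇒∣p^b*⇒∣ {p} {e} {d} p-prime p∤e (suc b) e∣p^b+1*d =
  prime∤⇒∣p^b*⇒∣ p-prime p∤e b
    (coprime-divisor (prime∤⇒coprime p-prime p∤e) (subst (e ∣_) (*-assoc p (p ^ b) d) e∣p^b+1*d))

record PrimePowerSplitting (p a r d : ℕ) : Set where
  constructor splitting
  field
    exponent cofactor : ℕ
    exponent≤ : exponent ≤ a
    cofactor∣ : cofactor ∣ r
    d≡ : d ≡ p ^ exponent * cofactor

split : ∀ {p r} → Prime p → ¬ p ∣ r → ∀ a {d} → d ∣ p ^ a * r → PrimePowerSplitting p a r d
split p-prime p∤r zero {d} d∣r =
  splitting 0 d z≤n (subst (d ∣_) (*-identityˡ _) d∣r) (sym (*-identityˡ d))
split {p} {r} p-prime p∤r (suc a) {d} d∣p^a+1*r with p ∣? d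
... | yes (divides q refl) with split p-prime p∤r a (prime-*-cancelˡ-∣ p-prime
                                (subst₂ _∣_ (*-comm q p) (*-assoc p (p ^ a) r) d∣p^a+1*r))
...   | splitting b e b≤a e∣r refl =
          splitting (suc b) e (s≤s b≤a) e∣r
            (trans (*-comm (p ^ b * e) p) (sym (*-assoc p (p ^ b) e)))
split {p} {r} p-prime p∤r (suc a) {d} d∣p^a+1*r | no p∤d
  with split p-prime p∤r a (coprime-divisor (prime∤⇒coprime p-prime p∤d)
                              (subst (d ∣_) (*-assoc p (p ^ a) r) d∣p^a+1*r))
... | splitting b e b≤a e∣r d≡ = splitting b e (m≤n⇒m≤1+n b≤a) e∣r d≡

p^b*e∣p^c*f⇒ : ∀ {p e f} → Prime p → ¬ p ∣ e → ¬ p ∣ f → ∀ b c →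
               p ^ b * e ∣ p ^ c * f → b ≤ c × e ∣ f
p^b*e∣p^c*f⇒ p-prime p∤e p∤f zero c e∣p^c*f =
  z≤n , prime∤⇒∣p^b*⇒∣ p-prime p∤e c (subst (_∣ _) (*-identityˡ _) e∣p^c*f)
p^b*e∣p^c*f⇒ {p} {e} p-prime p∤e p∤f (suc b) zero p^b+1*e∣f =
  ⊥-elim (p∤f (∣-trans (∣-trans (m∣m*n (p ^ b)) (m∣m*n e))
                       (subst (_ ∣_) (*-identityˡ _) p^b+1*e∣f)))
p^b*e∣p^c*f⇒ {p} {e} {f} p-prime p∤e p∤f (suc b) (suc c) p^b+1*e∣p^c+1*f
  with p^b*e∣p^c*f⇒ p-prime p∤e p∤f b c
         (prime-*-cancelˡ-∣ p-prime
           (subst₂ _∣_ (*-assoc p (p ^ b) e) (*-assoc p (p ^ c) f) p^b+1*e∣p^c+1*f))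
... | b≤c , e∣f = s≤s b≤c , e∣f

p^b*e≡p^c*f⇒ : ∀ {p e f} → Prime p → ¬ p ∣ e → ¬ p ∣ f → ∀ b c →
               p ^ b * e ≡ p ^ c * f → b ≡ c × e ≡ f
p^b*e≡p^c*f⇒ p-prime p∤e p∤f b c eq
  with p^b*e∣p^c*f⇒ p-prime p∤e p∤f b c (∣-reflexive eq)
     | p^b*e∣p^c*f⇒ p-prime p∤f p∤e c b (∣-reflexive (sym eq))
... | b≤c , e∣f | c≤b , f∣e = ≤-antisym b≤c c≤b , ∣-antisym e∣f f∣e

record DivisorIso (m n : ℕ) : Set where
  field
    to from : ℕ → ℕ
    to-∣ : ∀ {d} → d ∣ m → to d ∣ n
    from-∣ : ∀ {d} → d ∣ n → from d ∣ m
    from∘to : ∀ {d} → d ∣ m → from (to d) ≡ d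
    to∘from : ∀ {d} → d ∣ n → to (from d) ≡ d
    to-mono : ∀ {d d′} → d ∣ m → d′ ∣ m → d ∣ d′ → to d ∣ to d′
    from-mono : ∀ {d d′} → d ∣ n → d′ ∣ n → d ∣ d′ → from d ∣ from d′

divisorIso-sym : ∀ {m n} → DivisorIso m n → DivisorIso n m
divisorIso-sym I = record
  { to = from ; from = to ; to-∣ = from-∣ ; from-∣ = to-∣
  ; from∘to = to∘from ; to∘from = from∘to ; to-mono = from-mono ; from-mono = to-mono }
  where open DivisorIso I

divisorIso-1 : DivisorIso 1 1
divisorIso-1 = record
  { to = id ; from = id ; to-∣ = id ; from-∣ = id
  ; from∘to = λ _ → refl ; to∘from = λ _ → refl
  ; to-mono = λ _ _ → id ; from-mono = λ _ _ → id }

module PrimePowerExtension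
  {p q r s : ℕ} (p-prime : Prime p) (p∤r : ¬ p ∣ r) (q-prime : Prime q) (q∤s : ¬ q ∣ s) (a : ℕ)
  where

  extend : (ℕ → ℕ) → ℕ → ℕ
  extend f d with d ∣? p ^ a * r
  ... | yes d∣p^a*r = let open PrimePowerSplitting (split p-prime p∤r a d∣p^a*r)
                      in q ^ exponent * f cofactor
  ... | no _ = 0

  p∤divisor : ∀ {e} → e ∣ r → ¬ p ∣ e
  p∤divisor e∣r p∣e = p∤r (∣-trans p∣e e∣r)

  extend-p^b* : ∀ f {b e} → b ≤ a → e ∣ r → extend f (p ^ b * e) ≡ q ^ b * f e
  extend-p^b* f {b} {e} b≤a e∣r with p ^ b * e ∣? p ^ a * r
  ... | no p^b*e∤ = ⊥-elim (p^b*e∤ (*-pres-∣ (^-monoʳ-∣ p b≤a) e∣r))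
  ... | yes p^b*e∣ with split p-prime p∤r a p^b*e∣
  ...   | splitting c e′ _ e′∣r eq with p^b*e≡p^c*f⇒ p-prime (p∤divisor e∣r) (p∤divisor e′∣r) b c eq
  ...     | refl , refl = refl

  extend-∣ : ∀ {f} → (∀ {e} → e ∣ r → f e ∣ s) → ∀ {d} → d ∣ p ^ a * r → extend f d ∣ q ^ a * s
  extend-∣ {f} f-∣ d∣p^a*r with split p-prime p∤r a d∣p^a*r
  ... | splitting b e b≤a e∣r refl =
    subst (_∣ q ^ a * s) (sym (extend-p^b* f b≤a e∣r)) (*-pres-∣ (^-monoʳ-∣ q b≤a) (f-∣ e∣r))

  extend-mono : ∀ {f} → (∀ {e e′} → e ∣ r → e′ ∣ r → e ∣ e′ → f e ∣ f e′) →
                ∀ {d d′} → d ∣ p ^ a * r → d′ ∣ p ^ a * r → d ∣ d′ → extend f d ∣ extend f d′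
  extend-mono {f} f-mono d∣p^a*r d′∣p^a*r d∣d′
    with split p-prime p∤r a d∣p^a*r | split p-prime p∤r a d′∣p^a*r
  ... | splitting b e b≤a e∣r refl | splitting c e′ c≤a e′∣r refl
    with p^b*e∣p^c*f⇒ p-prime (p∤divisor e∣r) (p∤divisor e′∣r) b c d∣d′
  ... | b≤c , e∣e′ = subst₂ _∣_ (sym (extend-p^b* f b≤a e∣r)) (sym (extend-p^b* f c≤a e′∣r))
                       (*-pres-∣ (^-monoʳ-∣ q b≤c) (f-mono e∣r e′∣r e∣e′))

module _ {p q r s : ℕ} (p-prime : Prime p) (p∤r : ¬ p ∣ r) (q-prime : Prime q) (q∤s : ¬ q ∣ s)
         (a : ℕ) where
  open PrimePowerExtension p-prime p∤r q-prime q∤s a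
  open PrimePowerExtension q-prime q∤s p-prime p∤r a using ()
    renaming (extend to extend⁻¹; extend-p^b* to extend⁻¹-q^b*)

  extend-inverseˡ : ∀ {f g} → (∀ {e} → e ∣ r → f e ∣ s) → (∀ {e} → e ∣ r → g (f e) ≡ e) →
                    ∀ {d} → d ∣ p ^ a * r → extend⁻¹ g (extend f d) ≡ d
  extend-inverseˡ {f} {g} f-∣ g∘f d∣p^a*r with split p-prime p∤r a d∣p^a*r
  ... | splitting b e b≤a e∣r refl = begin
    extend⁻¹ g (extend f (p ^ b * e)) ≡⟨ cong (extend⁻¹ g) (extend-p^b* f b≤a e∣r) ⟩
    extend⁻¹ g (q ^ b * f e)          ≡⟨ extend⁻¹-q^b* g b≤a (f-∣ e∣r) ⟩
    p ^ b * g (f e)                   ≡⟨ cong (p ^ b *_) (g∘f e∣r) ⟩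
    p ^ b * e                         ∎
    where open ≡-Reasoning

divisorIso-extend : ∀ {p q r s} → Prime p → ¬ p ∣ r → Prime q → ¬ q ∣ s →
                    ∀ a → DivisorIso r s → DivisorIso (p ^ a * r) (q ^ a * s)
divisorIso-extend p-prime p∤r q-prime q∤s a I = record
  { to = To.extend to ; from = From.extend from
  ; to-∣ = To.extend-∣ to-∣ ; from-∣ = From.extend-∣ from-∣
  ; from∘to = extend-inverseˡ p-prime p∤r q-prime q∤s a to-∣ from∘to
  ; to∘from = extend-inverseˡ q-prime q∤s p-prime p∤r a from-∣ to∘from
  ; to-mono = To.extend-mono to-mono ; from-mono = From.extend-mono from-mono }
  where
  open DivisorIso I
  module To = PrimePowerExtension p-prime p∤r q-prime q∤s a
  module From = PrimePowerExtension q-prime q∤s p-prime p∤r a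

productOfPowers : List (ℕ × ℕ) → ℕ
productOfPowers fs = product (map (λ pe → proj₁ pe ^ proj₂ pe) fs)

prime∉⇒∤productOfPowers : ∀ {p} → Prime p → ∀ fs → All (λ qb → Prime (proj₁ qb)) fs →
                           All (p ≢_) (map proj₁ fs) → ¬ p ∣ productOfPowers fs
prime∉⇒∤productOfPowers p-prime [] [] [] = prime∤1 p-prime
prime∉⇒∤productOfPowers p-prime ((q , b) ∷ fs) (q-prime ∷ fs-prime) (p≢q ∷ p∉fs) p∣q^b*rest
  with euclidsLemma _ _ p-prime p∣q^b*rest
... | inj₁ p∣q^b = p≢q (prime∣^⇒≡ p-prime q-prime b p∣q^b)
... | inj₂ p∣rest = prime∉⇒∤productOfPowers p-prime fs fs-prime p∉fs p∣rest

divisorIso-productOfPowers :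
  ∀ fs gs → All (λ pa → Prime (proj₁ pa)) fs → Unique (map proj₁ fs) →
  All (λ qb → Prime (proj₁ qb)) gs → Unique (map proj₁ gs) →
  map proj₂ fs ≡ map proj₂ gs → DivisorIso (productOfPowers fs) (productOfPowers gs)
divisorIso-productOfPowers [] [] _ _ _ _ _ = divisorIso-1
divisorIso-productOfPowers ((p , a) ∷ fs) ((q , b) ∷ gs)
  (p-prime ∷ fs-prime) (p∉fs ∷ fs-unique) (q-prime ∷ gs-prime) (q∉gs ∷ gs-unique) exponents≡
  with Listₚ.∷-injective exponents≡
... | refl , exponents≡′ =
  divisorIso-extend p-prime (prime∉⇒∤productOfPowers p-prime fs fs-prime p∉fs)
                    q-prime (prime∉⇒∤productOfPowers q-prime gs gs-prime q∉gs) a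
                    (divisorIso-productOfPowers fs gs fs-prime fs-unique gs-prime gs-unique exponents≡′)

coprime⇒lcm≡* : ∀ {a b} → Coprime a b → lcm a b ≡ a * b
coprime⇒lcm≡* {a} {b} coprime = begin
  lcm a b           ≡⟨ *-identityˡ (lcm a b) ⟨
  1 * lcm a b       ≡⟨ cong (_* lcm a b) (coprime⇒gcd≡1 coprime) ⟨
  gcd a b * lcm a b ≡⟨ gcd*lcm a b ⟩
  a * b             ∎
  where open ≡-Reasoning

module DivisorIsoProperties {m n : ℕ} (I : DivisorIso m n) where
  open DivisorIso I

  ∣to⇒from∣ : ∀ {c a} → c ∣ n → a ∣ m → c ∣ to a → from c ∣ a
  ∣to⇒from∣ c∣n a∣m c∣to-a = subst (_ ∣_) (from∘to a∣m) (from-mono c∣n (to-∣ a∣m) c∣to-a)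

  to∣⇒∣from : ∀ {a c} → a ∣ m → c ∣ n → to a ∣ c → a ∣ from c
  to∣⇒∣from a∣m c∣n to-a∣c = subst (_∣ _) (from∘to a∣m) (from-mono (to-∣ a∣m) c∣n to-a∣c)

  to-1 : to 1 ≡ 1
  to-1 = ∣1⇒≡1 (subst (to 1 ∣_) (to∘from (1∣ n)) (to-mono (1∣ m) (from-∣ (1∣ n)) (1∣ _)))

  to-coprime : ∀ {a b} → a ∣ m → b ∣ m → Coprime a b → Coprime (to a) (to b)
  to-coprime a∣m b∣m coprime {c} (c∣to-a , c∣to-b) = begin
    c           ≡⟨ to∘from c∣n ⟨
    to (from c) ≡⟨ cong to (coprime (∣to⇒from∣ c∣n a∣m c∣to-a , ∣to⇒from∣ c∣n b∣m c∣to-b)) ⟩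
    to 1        ≡⟨ to-1 ⟩
    1           ∎
    where
    open ≡-Reasoning
    c∣n = ∣-trans c∣to-a (to-∣ a∣m)

  to-lcm : ∀ {a b} → a ∣ m → b ∣ m → to (lcm a b) ≡ lcm (to a) (to b)
  to-lcm {a} {b} a∣m b∣m = ∣-antisym to-lcm∣lcm-to lcm-to∣to-lcm
    where
    lcm∣m : lcm a b ∣ m
    lcm∣m = lcm-least a∣m b∣m
    lcm-to∣n : lcm (to a) (to b) ∣ n
    lcm-to∣n = lcm-least (to-∣ a∣m) (to-∣ b∣m)
    lcm-to∣to-lcm : lcm (to a) (to b) ∣ to (lcm a b)
    lcm-to∣to-lcm = lcm-least (to-mono a∣m lcm∣m (m∣lcm[m,n] a b)) (to-mono b∣m lcm∣m (n∣lcm[m,n] a b))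
    lcm∣from-lcm-to : lcm a b ∣ from (lcm (to a) (to b))
    lcm∣from-lcm-to = lcm-least (to∣⇒∣from a∣m lcm-to∣n (m∣lcm[m,n] (to a) (to b)))
                                (to∣⇒∣from b∣m lcm-to∣n (n∣lcm[m,n] (to a) (to b)))
    to-lcm∣lcm-to : to (lcm a b) ∣ lcm (to a) (to b)
    to-lcm∣lcm-to = subst (to (lcm a b) ∣_) (to∘from lcm-to∣n)
                      (to-mono lcm∣m (from-∣ lcm-to∣n) lcm∣from-lcm-to)

  to-*-coprime : ∀ {a b} → a ∣ m → b ∣ m → Coprime a b → to (a * b) ≡ to a * to b
  to-*-coprime {a} {b} a∣m b∣m coprime = begin
    to (a * b)         ≡⟨ cong to (coprime⇒lcm≡* coprime) ⟨
    to (lcm a b)       ≡⟨ to-lcm a∣m b∣m ⟩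
    lcm (to a) (to b)  ≡⟨ coprime⇒lcm≡* (to-coprime a∣m b∣m coprime) ⟩
    to a * to b        ∎
    where open ≡-Reasoning

module _ {A B : Set} {f : A → B} {g : B → A} where

  unique-map-leftInverse : ∀ {xs} → All (λ x → g (f x) ≡ x) xs → Unique xs → Unique (map f xs)
  unique-map-leftInverse {xs} g∘f≡id xs-unique = Uniqueₚ.map⁻ {f = g}
    (subst Unique (sym (trans (sym (Listₚ.map-∘ xs)) (Listₚ.map-id-local g∘f≡id))) xs-unique)

  ∈-map-leftInverse : ∀ {xs y} → All (λ x → g (f x) ≡ x) xs → y ∈ map f xs → g y ∈ xs
  ∈-map-leftInverse g∘f≡id y∈f[xs] with ∈-map⁻ f y∈f[xs]
  ... | x , x∈xs , refl = subst (_∈ _) (sym (All.lookup g∘f≡id x∈xs)) x∈xs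

  map-leftInverse : ∀ {j} (t : Vec A j) → (∀ i → g (f (lookup t i)) ≡ lookup t i) →
                    Vec.map g (Vec.map f t) ≡ t
  map-leftInverse [] _ = refl
  map-leftInverse (x ∷ t) g∘f≡id = cong₂ _∷_ (g∘f≡id zero) (map-leftInverse t (g∘f≡id ∘ suc))

atMost-leftInverse : ∀ {k} {P Q : ℕ → Set} (f g : ℕ → ℕ) → (∀ {z} → P z → g (f z) ≡ z) →
                     (∀ {z} → P z → Q (f z)) → AtMost k Q → AtMost k P
atMost-leftInverse {k} f g g∘f≡id P⇒Q atMost-Q zs zs-unique zs-P =
  subst (_≤ k) (Listₚ.length-map f zs)
    (atMost-Q (map f zs) (unique-map-leftInverse {g = g} (All.map g∘f≡id zs-P) zs-unique)
                         (Allₚ.map⁺ (All.map P⇒Q zs-P)))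

module Transport
  {m n j k : ℕ} (I : DivisorIso m n) {U : List (Vec ℕ j)} {g : Vec ℕ j → ℕ}
  (U-unique : Unique U) (U-regular : All (λ t → DivTuple m t × PairwiseCoprime t) U)
  (g∣m : All (λ t → g t ∣ m) U) (g-coprime : All (λ t → ∀ i → Coprime (g t) (lookup t i)) U)
  (g-fibres : ∀ i t d → AtMost k (λ z → ((t [ i ]≔ z) ∈ U) × g (t [ i ]≔ z) ≡ d))
  (zg-fibres : ∀ i t d → AtMost k (λ z → ((t [ i ]≔ z) ∈ U) × z * g (t [ i ]≔ z) ≡ d))
  where

  open DivisorIso I
  open DivisorIsoProperties I
  open DivisorIsoProperties (divisorIso-sym I) using () renaming (to-*-coprime to from-*-coprime)

  Φ Ψ : Vec ℕ j → Vec ℕ j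
  Φ = Vec.map to
  Ψ = Vec.map from

  U′ : List (Vec ℕ j)
  U′ = map Φ U

  g′ : Vec ℕ j → ℕ
  g′ t = to (g (Ψ t))

  module _ {t : Vec ℕ j} (t∈U : t ∈ U) where

    Ψ∘Φ : Ψ (Φ t) ≡ t
    Ψ∘Φ = map-leftInverse t (λ i → from∘to (proj₁ (All.lookup U-regular t∈U) i))

    g′∘Φ : g′ (Φ t) ≡ to (g t)
    g′∘Φ = cong (to ∘ g) Ψ∘Φ

  U′-unique : Unique U′
  U′-unique = unique-map-leftInverse {g = Ψ} (All.tabulate Ψ∘Φ) U-unique

  U′-regular : All (λ t → DivTuple n t × PairwiseCoprime t) U′
  U′-regular = Allₚ.map⁺ (All.tabulate λ {t} t∈U →
    let (t∣m , t-coprime) = All.lookup U-regular t∈U in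
    (λ i → subst (_∣ n) (sym (Vecₚ.lookup-map i to t)) (to-∣ (t∣m i))) ,
    (λ i i′ i≢i′ → subst₂ Coprime (sym (Vecₚ.lookup-map i to t)) (sym (Vecₚ.lookup-map i′ to t))
                     (to-coprime (t∣m i) (t∣m i′) (t-coprime i i′ i≢i′))))

  g′∣n : All (λ t → g′ t ∣ n) U′
  g′∣n = Allₚ.map⁺ (All.tabulate λ {t} t∈U →
    subst (_∣ n) (sym (g′∘Φ t∈U)) (to-∣ (All.lookup g∣m t∈U)))

  g′-coprime : All (λ t → ∀ i → Coprime (g′ t) (lookup t i)) U′
  g′-coprime = Allₚ.map⁺ (All.tabulate λ {t} t∈U i →
    let t∣m = proj₁ (All.lookup U-regular t∈U) in
    subst₂ Coprime (sym (g′∘Φ t∈U)) (sym (Vecₚ.lookup-map i to t))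
      (to-coprime (All.lookup g∣m t∈U) (t∣m i) (All.lookup g-coprime t∈U i)))

  module _ {i : Fin j} {t : Vec ℕ j} {z : ℕ} (t[i]≔z∈U′ : (t [ i ]≔ z) ∈ U′) where

    Ψ[]≔∈U : (Ψ t [ i ]≔ from z) ∈ U
    Ψ[]≔∈U = subst (_∈ U) (Vecₚ.map-[]≔ from t i)
               (∈-map-leftInverse {g = Ψ} (All.tabulate Ψ∘Φ) t[i]≔z∈U′)

    g∘Ψ[]≔ : g (Ψ t [ i ]≔ from z) ≡ from (g′ (t [ i ]≔ z))
    g∘Ψ[]≔ = trans (sym (from∘to (All.lookup g∣m Ψ[]≔∈U)))
                   (cong (from ∘ to ∘ g) (sym (Vecₚ.map-[]≔ from t i)))

    z∣n : z ∣ n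
    z∣n = subst (_∣ n) (Vecₚ.lookup∘update i t z) (proj₁ (All.lookup U′-regular t[i]≔z∈U′) i)

    z-coprime : Coprime z (g′ (t [ i ]≔ z))
    z-coprime = subst (λ x → Coprime x (g′ (t [ i ]≔ z))) (Vecₚ.lookup∘update i t z)
                  (Coprime.sym (All.lookup g′-coprime t[i]≔z∈U′ i))

    z*g∘Ψ[]≔ : from z * g (Ψ t [ i ]≔ from z) ≡ from (z * g′ (t [ i ]≔ z))
    z*g∘Ψ[]≔ = begin
      from z * g (Ψ t [ i ]≔ from z)    ≡⟨ cong (from z *_) g∘Ψ[]≔ ⟩
      from z * from (g′ (t [ i ]≔ z))   ≡⟨ from-*-coprime z∣n (All.lookup g′∣n t[i]≔z∈U′) z-coprime ⟨
      from (z * g′ (t [ i ]≔ z))        ∎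
      where open ≡-Reasoning

  atMost-from : ∀ i t {P Q : ℕ → Set} → (∀ {z} → P z → (t [ i ]≔ z) ∈ U′) →
                (∀ {z} → P z → Q (from z)) → AtMost k Q → AtMost k P
  atMost-from i t ∈U′ = atMost-leftInverse from to λ Pz → to∘from (z∣n (∈U′ Pz))

  g′-fibres : ∀ i t d → AtMost k (λ z → ((t [ i ]≔ z) ∈ U′) × g′ (t [ i ]≔ z) ≡ d)
  g′-fibres i t d = atMost-from i t proj₁
    (λ (∈U′ , g′≡d) → Ψ[]≔∈U ∈U′ , trans (g∘Ψ[]≔ ∈U′) (cong from g′≡d))
    (g-fibres i (Ψ t) (from d))

  zg′-fibres : ∀ i t d → AtMost k (λ z → ((t [ i ]≔ z) ∈ U′) × z * g′ (t [ i ]≔ z) ≡ d)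
  zg′-fibres i t d = atMost-from i t proj₁
    (λ (∈U′ , zg′≡d) → Ψ[]≔∈U ∈U′ , trans (z*g∘Ψ[]≔ ∈U′) (cong from zg′≡d))
    (zg-fibres i (Ψ t) (from d))

  U′-g′-kRegular : KRegular n j k U′ g′
  U′-g′-kRegular = (U′-unique , U′-regular) , g′∣n , g′-coprime , g′-fibres , zg′-fibres

transport : ∀ {m n j k} → DivisorIso m n → ∀ {U g} → KRegular m j k U g →
            Σ (List (Vec ℕ j)) λ U′ → Σ (Vec ℕ j → ℕ) λ g′ → KRegular n j k U′ g′ × length U′ ≡ length U
transport I {U} ((U-unique , U-regular) , g∣m , g-coprime , g-fibres , zg-fibres) =
  U′ , g′ , U′-g′-kRegular , Listₚ.length-map Φ U
  where open Transport I U-unique U-regular g∣m g-coprime g-fibres zg-fibres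

hasNu⇒divisorIso : ∀ {m n v} → HasNu m v → HasNu n v → DivisorIso m n
hasNu⇒divisorIso (fs , fs-prime , fs-unique , _ , _ , fs-exponents , refl)
                 (gs , gs-prime , gs-unique , _ , _ , gs-exponents , refl) =
  divisorIso-productOfPowers fs gs fs-prime fs-unique gs-prime gs-unique
    (trans fs-exponents (sym gs-exponents))

isE-transport : ∀ {j k m n e} → DivisorIso m n → IsE j k m e → IsE j k n e
isE-transport I ((U , g , kRegular , |U|≡e) , maximal) =
  (let U′ , g′ , kRegular′ , |U′|≡|U| = transport I kRegular
   in U′ , g′ , kRegular′ , trans |U′|≡|U| |U|≡e) ,
  λ U′ g′ kRegular′ → let U , g , kRegular , |U|≡|U′| = transport (divisorIso-sym I) kRegular′
                      in subst (_≤ _) |U|≡|U′| (maximal U g kRegular)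

lemma1 : (j k : ℕ) → 1 ≤ j → 1 ≤ k → (m n : ℕ) → 1 ≤ m → 1 ≤ n →
    (v : List ℕ) → HasNu m v → HasNu n v →
    (e : ℕ) → IsE j k m e ⇔ IsE j k n e
lemma1 j k _ _ m n _ _ v m-factorisation n-factorisation e =
  mk⇔ (isE-transport I) (isE-transport (divisorIso-sym I))
  where I = hasNu⇒divisorIso m-factorisation n-factorisation
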